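{- Let $a^2,b^2,c^2,d^2,e^2,f^2,g^2,h^2,i^2$ be a primitive magic square of squares with central entry $e^2$. If $e^2$ is divisible by one of the primes $2,5,13,$ or $17$, then at least one other entry of the square is divisible by that same prime.
   Context: A magic square of squares is a $3\times 3$ grid of $9$ distinct integer squares (arranged with $a^2,b^2,c^2$ in the top row, $d^2,e^2,f^2$ in the middle row, $g^2,h^2,i^2$ in the bottom row) such that the entries of each row, each column and both main diagonals sum to the same total $T$ (necessarily $T=3e^2$). It is primitive if the greatest common divisor of all its entries is $1$. -}

module Defs where

open import Data.Nat using (ℕ; _+_; _*_; _^_)
open import Data.Nat.Divisibility using (_∣_)
open import Data.Nat.GCD using (gcd)
open import Data.Fin using (Fin; zero; suc)
open import Data.Product using (_×_)
open import Relation.Binary.PropositionalEquality using (_≡_; _≢_)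

-- A 3×3 grid of naturals (the square roots of the entries), indexed
-- positions 0..8 in row-major order: a b c / d e f / g h i.
Grid : Set
Grid = Fin 9 → ℕ

entry : Grid → Fin 9 → ℕ
entry r k = r k ^ 2

pa pb pc pd pe pf pg ph pi : Fin 9
pa = zero
pb = suc zero
pc = suc (suc zero)
pd = suc (suc (suc zero))
pe = suc (suc (suc (suc zero)))
pf = suc (suc (suc (suc (suc zero))))
pg = suc (suc (suc (suc (suc (suc zero)))))
ph = suc (suc (suc (suc (suc (suc (suc zero))))))
pi = suc (suc (suc (suc (suc (suc (suc (suc zero)))))))

Distinct : Grid → Set
Distinct r = ∀ (k l : Fin 9) → k ≢ l → entry r k ≢ entry r l

Magic : Grid → Set
Magic r =
  let A = entry r pa ; B = entry r pb ; C = entry r pc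
      D = entry r pd ; E = entry r pe ; F = entry r pf
      G = entry r pg ; H = entry r ph ; I = entry r pi
      T = A + B + C
  in (D + E + F ≡ T) × (G + H + I ≡ T)
   × (A + D + G ≡ T) × (B + E + H ≡ T) × (C + F + I ≡ T)
   × (A + E + I ≡ T) × (C + E + G ≡ T)

gcdAll : Grid → ℕ
gcdAll r = gcd (entry r pa) (gcd (entry r pb) (gcd (entry r pc)
           (gcd (entry r pd) (gcd (entry r pe) (gcd (entry r pf)
           (gcd (entry r pg) (gcd (entry r ph) (entry r pi))))))))

MagicSquareOfSquares : Grid → Set
MagicSquareOfSquares r = Distinct r × Magic r

Primitive : Grid → Set
Primitive r = gcdAll r ≡ 1

{-# OPTIONS --safe #-}
-- Since T = 3e², the top row, the anti-diagonal and the left column give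
--   a² + b² + c² = 3e²,   c² + g² = 2e²,   a² + d² + g² = 3e².
-- If p divides e² but none of a², b², c², d², g², reducing this system modulo
-- p (modulo 4 when p = 2, where squares are 0 or 1) leaves a finite system of
-- congruences between squares of residues, and an exhaustive search over the
-- residues shows it has no solution for p = 2, 5, 13, 17. Neither primitivity
-- nor distinctness of the entries is needed.
module Submission where

open import Defs
open import Data.Nat using (ℕ; _+_; _*_; _^_; NonZero)
open import Data.Nat.Properties using (_≟_; +-cancelˡ-≡; +-cancelʳ-≡)
open import Data.Nat.DivMod using (_%_; m%n<n; m%n%n≡m%n; %-distribˡ-+; %-distribˡ-*; m∣n⇒o%n%m≡o%m)
open import Data.Nat.Divisibility using (_∣_; _∤_; _∣?_; divides; m%n≡0⇒n∣m; n∣m⇒m%n≡0)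
open import Data.Nat.Tactic.RingSolver using (solve-∀)
open import Data.Fin using (Fin; toℕ; fromℕ<)
open import Data.Fin.Properties using (all?; any?; toℕ-fromℕ<) renaming (_≟_ to _≟ᶠ_)
open import Data.Product using (_×_; ∃-syntax; _,_)
open import Data.Sum using (_⊎_; inj₁; inj₂)
open import Data.Empty using (⊥; ⊥-elim)
open import Relation.Nullary using (Dec; yes; no; ¬?; _→-dec_; _×-dec_)
open import Relation.Nullary.Decidable using (from-yes)
open import Relation.Binary.PropositionalEquality
open import Function using (_∘_)

magic-total : ∀ A B C D E F G H I → D + E + F ≡ A + B + C → G + H + I ≡ A + B + C →
  B + E + H ≡ A + B + C → A + E + I ≡ A + B + C → C + E + G ≡ A + B + C →
  A + B + C ≡ 3 * E
magic-total A B C D E F G H I row₂ row₃ col₂ diag anti =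
  +-cancelˡ-≡ (T + T + T) T (3 * E) (begin
    T + T + T + T
      ≡⟨ sym (cong₂ _+_ (cong₂ _+_ (cong₂ _+_ row₂ col₂) diag) anti) ⟩
    (D + E + F) + (B + E + H) + (A + E + I) + (C + E + G)
      ≡⟨ rearrange A B C D E F G H I ⟩
    T + (D + E + F) + (G + H + I) + 3 * E
      ≡⟨ cong (_+ 3 * E) (cong₂ _+_ (cong (T +_) row₂) row₃) ⟩
    T + T + T + 3 * E ∎)
  where
  open ≡-Reasoning
  T = A + B + C
  rearrange : ∀ A B C D E F G H I →
    (D + E + F) + (B + E + H) + (A + E + I) + (C + E + G) ≡
    (A + B + C) + (D + E + F) + (G + H + I) + 3 * E
  rearrange = solve-∀

m+e+n≡3e⇒m+n≡2e : ∀ m e n → m + e + n ≡ 3 * e → m + n ≡ 2 * e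
m+e+n≡3e⇒m+n≡2e m e n eq = +-cancelʳ-≡ e (m + n) (2 * e) (begin
  m + n + e   ≡⟨ move m e n ⟩
  m + e + n   ≡⟨ eq ⟩
  3 * e       ≡⟨ triple e ⟩
  2 * e + e   ∎)
  where
  open ≡-Reasoning
  move : ∀ m e n → m + n + e ≡ m + e + n
  move = solve-∀
  triple : ∀ e → 3 * e ≡ 2 * e + e
  triple = solve-∀

module Congruence (m : ℕ) .{{_ : NonZero m}} where

  infix 4 _≈_
  _≈_ : ℕ → ℕ → Set
  x ≈ y = x % m ≡ y % m

  %-≈ : ∀ x → x % m ≈ x
  %-≈ x = m%n%n≡m%n x m

  +-cong : ∀ {x x′ y y′} → x ≈ x′ → y ≈ y′ → x + y ≈ x′ + y′
  +-cong {x} {x′} {y} {y′} x≈x′ y≈y′ = begin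
    (x + y) % m                   ≡⟨ %-distribˡ-+ x y m ⟩
    (x % m + y % m) % m           ≡⟨ cong₂ (λ u v → (u + v) % m) x≈x′ y≈y′ ⟩
    (x′ % m + y′ % m) % m         ≡⟨ %-distribˡ-+ x′ y′ m ⟨
    (x′ + y′) % m                 ∎
    where open ≡-Reasoning

  *-cong : ∀ {x x′ y y′} → x ≈ x′ → y ≈ y′ → x * y ≈ x′ * y′
  *-cong {x} {x′} {y} {y′} x≈x′ y≈y′ = begin
    (x * y) % m                   ≡⟨ %-distribˡ-* x y m ⟩
    (x % m * (y % m)) % m         ≡⟨ cong₂ (λ u v → (u * v) % m) x≈x′ y≈y′ ⟩
    (x′ % m * (y′ % m)) % m       ≡⟨ %-distribˡ-* x′ y′ m ⟨
    (x′ * y′) % m                 ∎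
    where open ≡-Reasoning

  *-congˡ : ∀ k {y y′} → y ≈ y′ → k * y ≈ k * y′
  *-congˡ k = *-cong {k} {k} refl

  ^2-cong : ∀ {x x′} → x ≈ x′ → x ^ 2 ≈ x′ ^ 2
  ^2-cong x≈x′ = *-cong x≈x′ (*-cong x≈x′ refl)

  ∣-resp-≈ : ∀ {p x y} .{{_ : NonZero p}} → p ∣ m → x ≈ y → p ∣ x → p ∣ y
  ∣-resp-≈ {p} {x} {y} p∣m x≈y p∣x = m%n≡0⇒n∣m y p (begin
    y % p                         ≡⟨ m∣n⇒o%n%m≡o%m p m y p∣m ⟨
    y % m % p                     ≡⟨ cong (_% p) x≈y ⟨
    x % m % p                     ≡⟨ m∣n⇒o%n%m≡o%m p m x p∣m ⟩
    x % p                         ≡⟨ n∣m⇒m%n≡0 x p p∣x ⟩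
    0                             ∎)
    where open ≡-Reasoning

module Reduction (m p : ℕ) .{{_ : NonZero m}} .{{_ : NonZero p}} where
  open Congruence m

  -- Quantifiers and hypotheses are interleaved so that deciding this over
  -- residues prunes the search as soon as a hypothesis fails.
  Unsolvable : {X : Set} → (X → ℕ) → Set
  Unsolvable sq = ∀ e → p ∣ sq e → ∀ a → p ∤ sq a → ∀ b → p ∤ sq b → ∀ c → p ∤ sq c →
    sq a + sq b + sq c ≈ 3 * sq e → ∀ g → p ∤ sq g → sq c + sq g ≈ 2 * sq e →
    ∀ d → p ∤ sq d → sq a + sq d + sq g ≈ 3 * sq e → ⊥

  unsolvable-reduce : p ∣ m → {X Y : Set} {sqX : X → ℕ} {sqY : Y → ℕ} (ρ : Y → X) →
    (∀ y → sqX (ρ y) ≈ sqY y) → Unsolvable sqX → Unsolvable sqY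
  unsolvable-reduce p∣m ρ ρ-sq unsolvable e pe a pa b pb c pc abc g pg cg d pd adg =
    unsolvable (ρ e) (∣-resp-≈ p∣m (sym (ρ-sq e)) pe)
      (ρ a) (pa ∘ ∣-resp-≈ p∣m (ρ-sq a)) (ρ b) (pb ∘ ∣-resp-≈ p∣m (ρ-sq b))
      (ρ c) (pc ∘ ∣-resp-≈ p∣m (ρ-sq c))
      (trans (+-cong (+-cong (ρ-sq a) (ρ-sq b)) (ρ-sq c)) (trans abc (*-congˡ 3 (sym (ρ-sq e)))))
      (ρ g) (pg ∘ ∣-resp-≈ p∣m (ρ-sq g))
      (trans (+-cong (ρ-sq c) (ρ-sq g)) (trans cg (*-congˡ 2 (sym (ρ-sq e)))))
      (ρ d) (pd ∘ ∣-resp-≈ p∣m (ρ-sq d))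
      (trans (+-cong (+-cong (ρ-sq a) (ρ-sq d)) (ρ-sq g)) (trans adg (*-congˡ 3 (sym (ρ-sq e)))))

  residue : ℕ → Fin m
  residue x = fromℕ< (m%n<n x m)

  residue-square : ∀ x → toℕ (residue x) ^ 2 ≈ x ^ 2
  residue-square x = ^2-cong (trans (cong (_% m) (toℕ-fromℕ< (m%n<n x m))) (%-≈ x))

  unsolvable? : Dec (Unsolvable (λ (x : Fin m) → toℕ x ^ 2))
  unsolvable? =
    all? λ e → p ∣? sq e →-dec all? λ a → ¬? (p ∣? sq a) →-dec all? λ b → ¬? (p ∣? sq b) →-dec
    all? λ c → ¬? (p ∣? sq c) →-dec (sq a + sq b + sq c) % m ≟ (3 * sq e) % m →-dec
    all? λ g → ¬? (p ∣? sq g) →-dec (sq c + sq g) % m ≟ (2 * sq e) % m →-dec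
    all? λ d → ¬? (p ∣? sq d) →-dec (sq a + sq d + sq g) % m ≟ (3 * sq e) % m →-dec no λ ()
    where
    sq : Fin m → ℕ
    sq x = toℕ x ^ 2

  unsolvable-residues⇒unsolvable : p ∣ m → Unsolvable {Fin m} (λ x → toℕ x ^ 2) → Unsolvable {ℕ} (_^ 2)
  unsolvable-residues⇒unsolvable p∣m = unsolvable-reduce p∣m residue residue-square

open Reduction using (Unsolvable; unsolvable?; unsolvable-residues⇒unsolvable)

unsolvable-2 : Unsolvable 4 2 (_^ 2)
unsolvable-2 = unsolvable-residues⇒unsolvable 4 2 (divides 2 refl) (from-yes (unsolvable? 4 2))

unsolvable-5 : Unsolvable 5 5 (_^ 2)
unsolvable-5 = unsolvable-residues⇒unsolvable 5 5 (divides 1 refl) (from-yes (unsolvable? 5 5))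

unsolvable-13 : Unsolvable 13 13 (_^ 2)
unsolvable-13 = unsolvable-residues⇒unsolvable 13 13 (divides 1 refl) (from-yes (unsolvable? 13 13))

unsolvable-17 : Unsolvable 17 17 (_^ 2)
unsolvable-17 = unsolvable-residues⇒unsolvable 17 17 (divides 1 refl) (from-yes (unsolvable? 17 17))

divisor-off-centre : ∀ m p .{{_ : NonZero m}} .{{_ : NonZero p}} → Unsolvable m p (_^ 2) →
  (r : Grid) → Magic r → p ∣ entry r pe → ∃[ k ] (k ≢ pe × p ∣ entry r k)
divisor-off-centre m p unsolvable r (row₂ , row₃ , col₁ , col₂ , _ , diag , anti) p∣e
  with any? (λ k → ¬? (k ≟ᶠ pe) ×-dec p ∣? entry r k)
... | yes divisor = divisor
... | no none = ⊥-elim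
  (unsolvable (r pe) p∣e (r pa) (off-centre pa (λ ())) (r pb) (off-centre pb (λ ()))
    (r pc) (off-centre pc (λ ())) (cong (_% m) top)
    (r pg) (off-centre pg (λ ())) (cong (_% m) (m+e+n≡3e⇒m+n≡2e C E G (trans anti top)))
    (r pd) (off-centre pd (λ ())) (cong (_% m) (trans col₁ top)))
  where
  off-centre : ∀ k → k ≢ pe → p ∤ entry r k
  off-centre k k≢e p∣k = none (k , k≢e , p∣k)
  A = entry r pa ; B = entry r pb ; C = entry r pc
  E = entry r pe ; G = entry r pg
  top : A + B + C ≡ 3 * E
  top = magic-total A B C (entry r pd) E (entry r pf) G (entry r ph) (entry r pi)
    row₂ row₃ col₂ diag anti

corollary5p2 : (r : Grid) → MagicSquareOfSquares r → Primitive r →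
    (p : ℕ) → (p ≡ 2 ⊎ p ≡ 5 ⊎ p ≡ 13 ⊎ p ≡ 17) → p ∣ entry r pe →
    ∃[ k ] (k ≢ pe × p ∣ entry r k)
corollary5p2 r (_ , magic) _ .2 (inj₁ refl) = divisor-off-centre 4 2 unsolvable-2 r magic
corollary5p2 r (_ , magic) _ .5 (inj₂ (inj₁ refl)) = divisor-off-centre 5 5 unsolvable-5 r magic
corollary5p2 r (_ , magic) _ .13 (inj₂ (inj₂ (inj₁ refl))) = divisor-off-centre 13 13 unsolvable-13 r magic
corollary5p2 r (_ , magic) _ .17 (inj₂ (inj₂ (inj₂ refl))) = divisor-off-centre 17 17 unsolvable-17 r magic
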